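{- For every integer $n\ge 4$ there exists a connected bipartite $n$-regular graph with $2^n$ vertices that is not isomorphic to the $n$-hypercube graph $Q_n$.
   Context: The $n$-hypercube graph $Q_n$ has vertex set $\{0,1\}^n$, two vertices being adjacent iff they differ in exactly one coordinate. -}

module Defs where

open import Data.Nat using (ℕ; zero; suc; _+_)
open import Data.Bool using (Bool; true; false; if_then_else_; _xor_)
open import Data.Fin using (Fin)
open import Data.Vec using (Vec; []; _∷_)
open import Data.List using (List; filter; length)
open import Data.List using () renaming (allFin to allFinL)
open import Data.Product using (Σ; _×_; _,_)
open import Relation.Binary.PropositionalEquality using (_≡_; _≢_)
open import Relation.Nullary using (¬_)
open import Relation.Nullary.Decidable using (does)
open import Function.Bundles using (_↔_; Inverse)
open import Data.Bool.Properties using (_≟_)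

record FinGraph (m : ℕ) : Set where
  field
    adj   : Fin m → Fin m → Bool
    sym   : ∀ u v → adj u v ≡ adj v u
    irrefl : ∀ v → adj v v ≡ false
open FinGraph public

degree : ∀ {m} → FinGraph m → Fin m → ℕ
degree {m} G v = length (filter (λ u → adj G v u ≟ true) (allFinL m))

Regular : ∀ {m} → ℕ → FinGraph m → Set
Regular d G = ∀ v → degree G v ≡ d

data Walk {m} (G : FinGraph m) : Fin m → Fin m → Set where
  here : ∀ {v} → Walk G v v
  step : ∀ {u w v} → adj G u w ≡ true → Walk G w v → Walk G u v

Connected : ∀ {m} → FinGraph m → Set
Connected G = ∀ u v → Walk G u v

Bipartite : ∀ {m} → FinGraph m → Set
Bipartite {m} G = Σ (Fin m → Bool) λ c → ∀ u v → adj G u v ≡ true → c u ≢ c v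

hamming : ∀ {n} → Vec Bool n → Vec Bool n → ℕ
hamming []       []       = 0
hamming (x ∷ xs) (y ∷ ys) = (if x xor y then 1 else 0) + hamming xs ys

QAdj : ∀ {n} → Vec Bool n → Vec Bool n → Set
QAdj x y = hamming x y ≡ 1

IsoToHypercube : ∀ {m} → FinGraph m → ℕ → Set
IsoToHypercube {m} G n =
  Σ (Fin m ↔ Vec Bool n) λ f →
    ∀ u v → (adj G u v ≡ true → QAdj (Inverse.to f u) (Inverse.to f v))
          × (QAdj (Inverse.to f u) (Inverse.to f v) → adj G u v ≡ true)

module Submission where

-- Write D(H, π) for the double of a graph H along a permutation π of its vertices: two copies
-- of H with vertex i of copy 0 joined to vertex π i of copy 1.  Doubling along the identity
-- turns Q_r into Q_(r+1), and doubling along any π that preserves a proper 2-colouring keeps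
-- a graph connected and bipartite while raising its degree by one.  In Q_n every path u – w – v
-- with u ≠ v lies on a 4-cycle.  Take a path i – j – k in Q_(n-2) and double Q_(n-1) =
-- D(Q_(n-2), id) along the transposition τ of a = (0,i) and b = (1,j), which have the same
-- colour.  In the result the path (0,a) – (1,b) – (1,y), y = (1,k), lies on no 4-cycle:
-- a common neighbour of its ends in copy 1 is τ a = b, and one in copy 0 is τ⁻¹ y = y, which
-- is not adjacent to a.

open import Defs hiding (sym)
open import Data.Bool using (Bool; true; false; if_then_else_; not)
open import Data.Bool.Properties using (not-¬; ¬-not; not-injective) renaming (_≟_ to _≟ᵇ_)
open import Data.Fin using (Fin; zero; suc; _↑ˡ_; _↑ʳ_; combine; remQuot; fromℕ<)
open import Data.Fin.Patterns using (0F; 1F)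
open import Data.Fin.Permutation
  using (Permutation′; id; transpose; _⟨$⟩ʳ_; _⟨$⟩ˡ_; inverseˡ; inverseʳ)
open import Data.Fin.Properties using (_≟_; remQuot-combine; combine-remQuot; combine-injectiveˡ)
open import Data.List using (length; filter; tabulate)
open import Data.Nat using (ℕ; zero; suc; _+_; _*_; _^_; _≤_; s≤s)
open import Data.Nat.Properties using (+-comm; +-identityʳ; suc-injective; m^n>0)
open import Data.Product using (Σ; _×_; _,_; proj₁; proj₂; uncurry)
open import Data.Vec using (Vec; []; _∷_)
open import Data.Vec.Properties using (∷-injectiveʳ)
open import Function using (_∘_)
open import Function.Bundles using (Inverse; Injection; mk⇔)
open import Function.Properties.Inverse using (↔⇒↣)
open import Relation.Binary.PropositionalEquality
  using (_≡_; _≢_; _≗_; refl; sym; trans; cong; cong₂; subst; ≢-sym; module ≡-Reasoning)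
open import Relation.Nullary using (¬_; does; yes; no; contradiction)
open import Relation.Nullary.Decidable using (dec-true; dec-false; does-⇔)

Adj : ∀ {m} → FinGraph m → Fin m → Fin m → Set
Adj G u v = adj G u v ≡ true

ProperColouring : ∀ {m} → FinGraph m → (Fin m → Bool) → Set
ProperColouring G c = ∀ u v → Adj G u v → c u ≢ c v

infixr 5 _++ʷ_

_++ʷ_ : ∀ {m} {G : FinGraph m} {u v w} → Walk G u v → Walk G v w → Walk G u w
here     ++ʷ q = q
step e p ++ʷ q = step e (p ++ʷ q)

reverseʷ : ∀ {m} {G : FinGraph m} {u v} → Walk G u v → Walk G v u
reverseʷ         here               = here
reverseʷ {G = G} (step {u} {w} e p) = reverseʷ p ++ʷ step (trans (FinGraph.sym G w u) e) here

≟-sound : ∀ {m} {x y : Fin m} → does (x ≟ y) ≡ true → x ≡ y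
≟-sound {x = x} {y} with x ≟ y
... | yes x≡y = λ _ → x≡y
... | no _    = λ ()

count : ∀ {m} → (Fin m → Bool) → ℕ
count {zero}  f = 0
count {suc m} f = if f zero then suc (count (f ∘ suc)) else count (f ∘ suc)

length-filter-tabulate : ∀ {A : Set} {m} (f : A → Bool) (g : Fin m → A) →
                         length (filter (λ x → f x ≟ᵇ true) (tabulate g)) ≡ count (f ∘ g)
length-filter-tabulate {m = zero}  f g = refl
length-filter-tabulate {m = suc m} f g with f (g zero)
... | true  = cong suc (length-filter-tabulate f (g ∘ suc))
... | false = length-filter-tabulate f (g ∘ suc)

degree≡count : ∀ {m} (G : FinGraph m) v → degree G v ≡ count (adj G v)
degree≡count G v = length-filter-tabulate (adj G v) (λ u → u)

count-cong : ∀ {m} {f g : Fin m → Bool} → f ≗ g → count f ≡ count g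
count-cong {zero}          f≗g = refl
count-cong {suc m} {f} {g} f≗g
  rewrite f≗g zero | count-cong {f = f ∘ suc} {g ∘ suc} (f≗g ∘ suc) = refl

count-↑ : ∀ m {n} (f : Fin (m + n) → Bool) → count f ≡ count (f ∘ (_↑ˡ n)) + count (f ∘ (m ↑ʳ_))
count-↑ zero    f = refl
count-↑ (suc m) f with f zero
... | true  = cong suc (count-↑ m (f ∘ suc))
... | false = count-↑ m (f ∘ suc)

count-false : ∀ m → count {m} (λ _ → false) ≡ 0
count-false zero    = refl
count-false (suc m) = count-false m

count-≟ : ∀ {m} (x : Fin m) → count (λ i → does (x ≟ i)) ≡ 1
count-≟ {suc m} zero    = cong suc (count-false m)
count-≟ {suc m} (suc x) = count-≟ x

count-preimage : ∀ {m} (π : Permutation′ m) y → count (λ x → does (π ⟨$⟩ʳ x ≟ y)) ≡ 1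
count-preimage π y =
  trans (count-cong (λ x → does-⇔ (mk⇔ to from) (π ⟨$⟩ʳ x ≟ y) (π ⟨$⟩ˡ y ≟ x))) (count-≟ (π ⟨$⟩ˡ y))
  where
  to : ∀ {x} → π ⟨$⟩ʳ x ≡ y → π ⟨$⟩ˡ y ≡ x
  to refl = inverseˡ π
  from : ∀ {x} → π ⟨$⟩ˡ y ≡ x → π ⟨$⟩ʳ x ≡ y
  from refl = inverseʳ π

-- A doubled vertex set Fin 2 × Fin m is encoded as Fin (2 * m) through combine/remQuot, so
-- that the r-fold double of a point has exactly 2 ^ r vertices.
copy : ∀ {m} → Fin 2 → Fin m → Fin (2 * m)
copy = combine

∀-copy : ∀ {m} {P : Fin (2 * m) → Set} → (∀ s i → P (copy s i)) → ∀ u → P u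
∀-copy {m} {P} h u = subst P (combine-remQuot {2} m u) (uncurry h (remQuot m u))

count-copy : ∀ {m} (f : Fin (2 * m) → Bool) → count f ≡ count {m} (f ∘ copy 0F) + count {m} (f ∘ copy 1F)
count-copy {m} f = begin
  count f                                     ≡⟨ count-↑ m f ⟩
  count (f ∘ left) + count (f ∘ (m ↑ʳ_))      ≡⟨ cong (count (f ∘ left) +_) (count-↑ m (f ∘ (m ↑ʳ_))) ⟩
  count (f ∘ left) + (count (f ∘ right) + 0)  ≡⟨ cong (count (f ∘ left) +_) (+-identityʳ _) ⟩
  count (f ∘ left) + count (f ∘ right)        ∎
  where
  open ≡-Reasoning
  left right : Fin m → Fin (2 * m)
  left  = copy 0F
  right = copy 1F

sideColour : ∀ {m} → (Fin m → Bool) → Fin 2 × Fin m → Bool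
sideColour c (0F , i) = c i
sideColour c (1F , i) = not (c i)

doubleColour : ∀ {m} → (Fin m → Bool) → Fin (2 * m) → Bool
doubleColour {m} c u = sideColour c (remQuot m u)

doubleColour-copy : ∀ {m} (c : Fin m → Bool) s i → doubleColour c (copy s i) ≡ sideColour c (s , i)
doubleColour-copy {m} c s i rewrite remQuot-combine {2} {m} s i = refl

module _ {m} (H : FinGraph m) (π : Permutation′ m) where

  doubleAdj : Fin 2 × Fin m → Fin 2 × Fin m → Bool
  doubleAdj (0F , i) (0F , j) = adj H i j
  doubleAdj (1F , i) (1F , j) = adj H i j
  doubleAdj (0F , i) (1F , j) = does (π ⟨$⟩ʳ i ≟ j)
  doubleAdj (1F , j) (0F , i) = does (π ⟨$⟩ʳ i ≟ j)

  double : FinGraph (2 * m)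
  double = record
    { adj    = λ u v → doubleAdj (remQuot m u) (remQuot m v)
    ; sym    = λ u v → doubleAdj-sym (remQuot m u) (remQuot m v)
    ; irrefl = λ v → doubleAdj-irrefl (remQuot m v)
    }
    where
    doubleAdj-sym : ∀ s t → doubleAdj s t ≡ doubleAdj t s
    doubleAdj-sym (0F , i) (0F , j) = FinGraph.sym H i j
    doubleAdj-sym (1F , i) (1F , j) = FinGraph.sym H i j
    doubleAdj-sym (0F , i) (1F , j) = refl
    doubleAdj-sym (1F , j) (0F , i) = refl
    doubleAdj-irrefl : ∀ s → doubleAdj s s ≡ false
    doubleAdj-irrefl (0F , i) = irrefl H i
    doubleAdj-irrefl (1F , i) = irrefl H i

  adj-double : ∀ u t j → adj double u (copy t j) ≡ doubleAdj (remQuot m u) (t , j)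
  adj-double u t j rewrite remQuot-combine {2} {m} t j = refl

  adj-double² : ∀ s i t j → adj double (copy s i) (copy t j) ≡ doubleAdj (s , i) (t , j)
  adj-double² s i t j rewrite remQuot-combine {2} {m} s i | remQuot-combine {2} {m} t j = refl

  adj-across : ∀ {i j} → Adj double (copy 0F i) (copy 1F j) → π ⟨$⟩ʳ i ≡ j
  adj-across {i} {j} e = ≟-sound (trans (sym (adj-double² 0F i 1F j)) e)

  double-regular : ∀ {r} → Regular r H → Regular (suc r) double
  double-regular {r} regular u = begin
    degree double u
      ≡⟨ degree≡count double u ⟩
    count (adj double u)
      ≡⟨ count-copy {m} (adj double u) ⟩
    count {m} (adj double u ∘ copy 0F) + count {m} (adj double u ∘ copy 1F)
      ≡⟨ cong₂ _+_ (count-cong (adj-double u 0F)) (count-cong (adj-double u 1F)) ⟩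
    count (doubleAdj (remQuot m u) ∘ (0F ,_)) + count (doubleAdj (remQuot m u) ∘ (1F ,_))
      ≡⟨ sides (remQuot m u) ⟩
    suc r ∎
    where
    open ≡-Reasoning
    count-adj : ∀ i → count (adj H i) ≡ r
    count-adj i = trans (sym (degree≡count H i)) (regular i)
    sides : ∀ s → count (doubleAdj s ∘ (0F ,_)) + count (doubleAdj s ∘ (1F ,_)) ≡ suc r
    sides (0F , i) = trans (cong₂ _+_ (count-adj i) (count-≟ (π ⟨$⟩ʳ i))) (+-comm r 1)
    sides (1F , j) = cong₂ _+_ (count-preimage π j) (count-adj j)

  double-proper : ∀ {c} → ProperColouring H c → (∀ i → c (π ⟨$⟩ʳ i) ≡ c i) →
                  ProperColouring double (doubleColour c)
  double-proper {c} proper c∘π≗c u v = sides (remQuot m u) (remQuot m v)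
    where
    across : ∀ {i j} → doubleAdj (0F , i) (1F , j) ≡ true → c i ≢ not (c j)
    across {i} e = not-¬ (trans (sym (c∘π≗c i)) (cong c (≟-sound e)))
    sides : ∀ s t → doubleAdj s t ≡ true → sideColour c s ≢ sideColour c t
    sides (0F , i) (0F , j) e = proper i j e
    sides (1F , i) (1F , j) e = proper i j e ∘ not-injective
    sides (0F , i) (1F , j) e = across e
    sides (1F , j) (0F , i) e = ≢-sym (across e)

  double-connected : Connected H → Connected double
  double-connected connected u v =
    let i , u⇝i = walkToCopy₀ u
        j , v⇝j = walkToCopy₀ v
    in  u⇝i ++ʷ liftWalk (connected i j) ++ʷ reverseʷ v⇝j
    where
    liftWalk : ∀ {i j} → Walk H i j → Walk double (copy 0F i) (copy 0F j)
    liftWalk here               = here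
    liftWalk (step {i} {k} e p) = step (trans (adj-double² 0F i 0F k) e) (liftWalk p)
    walkToCopy₀ : ∀ u → Σ (Fin m) λ i → Walk double u (copy 0F i)
    walkToCopy₀ = ∀-copy {P = λ u → Σ (Fin m) λ i → Walk double u (copy 0F i)} λ where
      0F i → i , here
      1F j → π ⟨$⟩ˡ j , step (trans (adj-double² 1F j 0F _) (dec-true (_ ≟ j) (inverseʳ π))) here

hamming-self : ∀ {n} (x : Vec Bool n) → hamming x x ≡ 0
hamming-self []          = refl
hamming-self (true ∷ x)  = hamming-self x
hamming-self (false ∷ x) = hamming-self x

hamming≡0⇒≡ : ∀ {n} (x y : Vec Bool n) → hamming x y ≡ 0 → x ≡ y
hamming≡0⇒≡ []          []          _ = refl
hamming≡0⇒≡ (true ∷ x)  (true ∷ y)  e = cong (true ∷_) (hamming≡0⇒≡ x y e)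
hamming≡0⇒≡ (false ∷ x) (false ∷ y) e = cong (false ∷_) (hamming≡0⇒≡ x y e)

tails-equal : ∀ {n} (x y : Vec Bool n) → suc (hamming x y) ≡ 1 → x ≡ y
tails-equal x y e = hamming≡0⇒≡ x y (suc-injective e)

flip-head : ∀ {n} (a : Bool) (x : Vec Bool n) → QAdj (a ∷ x) (not a ∷ x)
flip-head true  x = cong suc (hamming-self x)
flip-head false x = cong suc (hamming-self x)

OtherCommonNeighbour : ∀ {n} → Vec Bool n → Vec Bool n → Vec Bool n → Set
OtherCommonNeighbour x y z = Σ (Vec Bool _) λ w → QAdj x w × QAdj w z × w ≢ y

hypercube-square : ∀ {n} (x y z : Vec Bool n) → QAdj x y → QAdj y z → x ≢ z →
                   OtherCommonNeighbour x y z
hypercube-square [] [] [] () _ _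
hypercube-square (true ∷ x) (true ∷ y) (true ∷ z) xy yz x≢z =
  let w , xw , wz , w≢y = hypercube-square x y z xy yz (x≢z ∘ cong (true ∷_))
  in  true ∷ w , xw , wz , w≢y ∘ ∷-injectiveʳ
hypercube-square (false ∷ x) (false ∷ y) (false ∷ z) xy yz x≢z =
  let w , xw , wz , w≢y = hypercube-square x y z xy yz (x≢z ∘ cong (false ∷_))
  in  false ∷ w , xw , wz , w≢y ∘ ∷-injectiveʳ
hypercube-square (true ∷ x) (true ∷ y) (false ∷ z) xy yz _ =
  false ∷ x , flip-head true x , subst (QAdj x) (tails-equal y z yz) xy , λ ()
hypercube-square (false ∷ x) (false ∷ y) (true ∷ z) xy yz _ =
  true ∷ x , flip-head false x , subst (QAdj x) (tails-equal y z yz) xy , λ ()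
hypercube-square (true ∷ x) (false ∷ y) (false ∷ z) xy yz _ =
  true ∷ z , subst (λ t → QAdj t z) (sym (tails-equal x y xy)) yz , flip-head true z , λ ()
hypercube-square (false ∷ x) (true ∷ y) (true ∷ z) xy yz _ =
  false ∷ z , subst (λ t → QAdj t z) (sym (tails-equal x y xy)) yz , flip-head false z , λ ()
hypercube-square (true ∷ x) (false ∷ y) (true ∷ z) xy yz x≢z =
  contradiction (cong (true ∷_) (trans (tails-equal x y xy) (tails-equal y z yz))) x≢z
hypercube-square (false ∷ x) (true ∷ y) (false ∷ z) xy yz x≢z =
  contradiction (cong (false ∷_) (trans (tails-equal x y xy) (tails-equal y z yz))) x≢z

record TwoPath {m} (G : FinGraph m) : Set where
  field
    start middle end : Fin m
    start∼middle     : Adj G start middle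
    middle∼end       : Adj G middle end
    start≢end        : start ≢ end

  OnNoSquare : Set
  OnNoSquare = ∀ z → Adj G start z → Adj G z end → z ≡ middle

onNoSquare⇒¬IsoToHypercube : ∀ {m n} {G : FinGraph m} (p : TwoPath G) → TwoPath.OnNoSquare p →
                              ¬ IsoToHypercube G n
onNoSquare⇒¬IsoToHypercube p onNoSquare (f , preserves) =
  let w , uw , wv , w≢middle = hypercube-square (to start) (to middle) (to end)
                                 (proj₁ (preserves start middle) start∼middle)
                                 (proj₁ (preserves middle end) middle∼end)
                                 (start≢end ∘ Injection.injective (↔⇒↣ f))
      to-from-w = sym (strictlyInverseˡ w)
      from-w≡middle = onNoSquare (from w)
        (proj₂ (preserves start (from w)) (subst (QAdj (to start)) to-from-w uw))
        (proj₂ (preserves (from w) end) (subst (λ t → QAdj t (to end)) to-from-w wv))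
  in  w≢middle (trans to-from-w (cong to from-w≡middle))
  where
  open TwoPath p
  open Inverse f

module _ {m} (a b : Fin m) where

  transpose-maps : transpose a b ⟨$⟩ʳ a ≡ b
  transpose-maps rewrite dec-true (a ≟ a) refl = refl

  transpose-fixes : ∀ {k} → k ≢ a → k ≢ b → transpose a b ⟨$⟩ʳ k ≡ k
  transpose-fixes k≢a k≢b rewrite dec-false (_ ≟ a) k≢a | dec-false (_ ≟ b) k≢b = refl

  transpose-preserves : ∀ {A : Set} (c : Fin m → A) → c a ≡ c b → ∀ k → c (transpose a b ⟨$⟩ʳ k) ≡ c k
  transpose-preserves c ca≡cb k with k ≟ a
  ... | yes refl = sym ca≡cb
  ... | no _ with k ≟ b
  ...   | yes refl = ca≡cb
  ...   | no _     = refl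

module _ {m} (H : FinGraph m) {a b y : Fin m} (b∼y : Adj H b y) (a≁y : ¬ Adj H a y) (y≢a : y ≢ a) where

  private
    τ : Permutation′ m
    τ = transpose a b

    y≢b : y ≢ b
    y≢b refl = contradiction (trans (sym (irrefl H y)) b∼y) λ ()

    z≡y : ∀ {z} → Adj (double H τ) (copy 0F z) (copy 1F y) → z ≡ y
    z≡y z∼y = Injection.injective (↔⇒↣ τ)
                (trans (adj-across H τ z∼y) (sym (transpose-fixes a b y≢a y≢b)))

  twisted-twoPath : TwoPath (double H τ)
  twisted-twoPath = record
    { start        = copy 0F a
    ; middle       = copy 1F b
    ; end          = copy 1F y
    ; start∼middle = trans (adj-double² H τ 0F a 1F b) (dec-true (_ ≟ b) (transpose-maps a b))
    ; middle∼end   = trans (adj-double² H τ 1F b 1F y) b∼y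
    ; start≢end    = λ e → contradiction (combine-injectiveˡ {2} {m} 0F a 1F y e) λ ()
    }

  twisted-onNoSquare : TwoPath.OnNoSquare twisted-twoPath
  twisted-onNoSquare = ∀-copy λ where
    0F z a∼z z∼y →
      contradiction (subst (Adj H a) (z≡y z∼y) (trans (sym (adj-double² H τ 0F a 0F z)) a∼z)) a≁y
    1F z a∼z _   → cong (copy 1F) (trans (sym (adj-across H τ a∼z)) (transpose-maps a b))

twisted-counterexample : ∀ {m r} (H : FinGraph m) {c : Fin m → Bool} →
  Connected H → ProperColouring H c → Regular r H → TwoPath H →
  Σ (FinGraph (2 * (2 * m))) λ G →
    Connected G × Bipartite G × Regular (suc (suc r)) G × ¬ IsoToHypercube G (suc (suc r))
twisted-counterexample {m} H {c} connected proper regular p =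
    double K τ
  , double-connected K τ (double-connected H id connected)
  , ( doubleColour cK
    , double-proper K τ (double-proper H id proper λ _ → refl) (transpose-preserves a b cK cKa≡cKb))
  , double-regular K τ (double-regular H id regular)
  , onNoSquare⇒¬IsoToHypercube (twisted-twoPath K b∼y a≁y y≢a) (twisted-onNoSquare K b∼y a≁y y≢a)
  where
  open TwoPath p
  K : FinGraph (2 * m)
  K = double H id
  cK : Fin (2 * m) → Bool
  cK = doubleColour c
  a b y : Fin (2 * m)
  a = copy 0F start
  b = copy 1F middle
  y = copy 1F end
  τ : Permutation′ (2 * m)
  τ = transpose a b
  b∼y : Adj K b y
  b∼y = trans (adj-double² H id 1F middle 1F end) middle∼end
  a≁y : ¬ Adj K a y
  a≁y = start≢end ∘ adj-across H id
  y≢a : y ≢ a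
  y≢a e = contradiction (combine-injectiveˡ {2} {m} 1F end 0F start e) λ ()
  cKa≡cKb : cK a ≡ cK b
  cKa≡cKb = begin
    cK a             ≡⟨ doubleColour-copy c 0F start ⟩
    c start          ≡⟨ ¬-not (proper start middle start∼middle) ⟩
    not (c middle)   ≡⟨ doubleColour-copy c 1F middle ⟨
    cK b             ∎
    where open ≡-Reasoning

double²-twoPath : ∀ {m} (H : FinGraph m) → Fin m → TwoPath (double (double H id) id)
double²-twoPath H i = record
  { start        = copy 0F (copy 0F i)
  ; middle       = copy 0F (copy 1F i)
  ; end          = copy 1F (copy 1F i)
  ; start∼middle = trans (adj-double² (double H id) id 0F (copy 0F i) 0F (copy 1F i))
                         (trans (adj-double² H id 0F i 1F i) (dec-true (i ≟ i) refl))
  ; middle∼end   = trans (adj-double² (double H id) id 0F (copy 1F i) 1F (copy 1F i))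
                         (dec-true (copy 1F i ≟ copy 1F i) refl)
  ; start≢end    = λ e → contradiction (combine-injectiveˡ {2} 0F (copy 0F i) 1F (copy 1F i) e) λ ()
  }

cube : ∀ r → FinGraph (2 ^ r)
cube zero    = record { adj = λ _ _ → false ; sym = λ _ _ → refl ; irrefl = λ _ → refl }
cube (suc r) = double (cube r) id

cube-connected : ∀ r → Connected (cube r)
cube-connected zero    zero zero = here
cube-connected (suc r)           = double-connected (cube r) id (cube-connected r)

cubeColour : ∀ r → Fin (2 ^ r) → Bool
cubeColour zero    _ = true
cubeColour (suc r)   = doubleColour (cubeColour r)

cube-proper : ∀ r → ProperColouring (cube r) (cubeColour r)
cube-proper zero    _ _ ()
cube-proper (suc r) = double-proper (cube r) id (cube-proper r) (λ _ → refl)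

cube-regular : ∀ r → Regular r (cube r)
cube-regular zero    _ = refl
cube-regular (suc r)   = double-regular (cube r) id (cube-regular r)

mainTheorem5 : (n : ℕ) → 4 ≤ n →
    Σ (FinGraph (2 ^ n)) λ G →
      Connected G × Bipartite G × Regular n G × ¬ IsoToHypercube G n
mainTheorem5 (suc (suc n@(suc (suc r)))) _ =
  twisted-counterexample (cube n) (cube-connected n) (cube-proper n) (cube-regular n)
    (double²-twoPath (cube r) (fromℕ< (m^n>0 2 r)))
mainTheorem5 1 (s≤s ())
mainTheorem5 2 (s≤s (s≤s ()))
mainTheorem5 3 (s≤s (s≤s (s≤s ())))
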